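{- For every $n\ge1$, the number of elements of $C_2\wr S_n$ that simultaneously bi-avoid $(1\text{ - }2,0~0)$ and $(1\text{ - }2,0~1)$ equals the Catalan number $C_{n+1}=\frac{1}{n+2}\binom{2n+2}{n+1}$.
   Context: $C_2\wr S_n$ denotes the set of pairs $(\sigma,w)$ where $\sigma=\sigma_1\cdots\sigma_n$ is a permutation of $\{1,\dots,n\}$ in one-line notation and $w=w_1\cdots w_n\in\{0,1\}^n$. $(\sigma,w)$ bi-avoids $(1\text{ - }2,0~0)$ if there are no indices $i<j$ with $\sigma_i<\sigma_j$ and $w_i=w_j$; it bi-avoids $(1\text{ - }2,0~1)$ if there are no indices $i<j$ with $\sigma_i<\sigma_j$ and $w_i<w_j$ (i.e. $w_i=0,w_j=1$). -}

module Defs where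

open import Data.Nat using (ℕ; zero; suc; _+_; _*_; _/_)
open import Data.Nat.Combinatorics using (_C_)
open import Data.Fin using (Fin; _<_)
open import Data.Fin.Properties using (all?; _<?_) renaming (_≟_ to _≟F_)
open import Data.Bool using (Bool; true; false)
open import Data.Bool.Properties using () renaming (_≟_ to _≟B_)
open import Data.Vec using (Vec; []; _∷_; lookup)
open import Data.List using (List; []; _∷_; concatMap; map; filter; length)
import Data.List as L
open import Data.Product using (_×_; _,_)
open import Relation.Nullary using (¬_; Dec; yes; no)
open import Relation.Nullary.Decidable using (_→-dec_; _×-dec_; ¬?)
open import Relation.Binary.PropositionalEquality using (_≡_; _≢_)

-- A signed permutation-like pair (σ , w) : σ in one-line notation as a vector
-- of values in Fin n (values 0..n-1 stand for 1..n), w a 0/1 word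
-- (false = 0, true = 1).

IsPerm : ∀ {n} → Vec (Fin n) n → Set
IsPerm {n} σ = (i j : Fin n) → lookup σ i ≡ lookup σ j → i ≡ j

BiAvoids00 : ∀ {n} → Vec (Fin n) n → Vec Bool n → Set
BiAvoids00 {n} σ w = (i j : Fin n) → i < j → lookup σ i < lookup σ j →
  lookup w i ≢ lookup w j

BiAvoids01 : ∀ {n} → Vec (Fin n) n → Vec Bool n → Set
BiAvoids01 {n} σ w = (i j : Fin n) → i < j → lookup σ i < lookup σ j →
  ¬ (lookup w i ≡ false × lookup w j ≡ true)

Good : ∀ {n} → Vec (Fin n) n × Vec Bool n → Set
Good (σ , w) = IsPerm σ × BiAvoids00 σ w × BiAvoids01 σ w

good? : ∀ {n} (p : Vec (Fin n) n × Vec Bool n) → Dec (Good p)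
good? {n} (σ , w) =
  all? (λ i → all? (λ j → (lookup σ i ≟F lookup σ j) →-dec (i ≟F j)))
  ×-dec all? (λ i → all? (λ j → (i <? j) →-dec ((lookup σ i <? lookup σ j)
          →-dec ¬? (lookup w i ≟B lookup w j))))
  ×-dec all? (λ i → all? (λ j → (i <? j) →-dec ((lookup σ i <? lookup σ j)
          →-dec ¬? ((lookup w i ≟B false) ×-dec (lookup w j ≟B true)))))

allVecs : ∀ {A : Set} → List A → (k : ℕ) → List (Vec A k)
allVecs xs zero = [] ∷ []
allVecs xs (suc k) = concatMap (λ x → map (x ∷_) (allVecs xs k)) xs

allBools : List Bool
allBools = false ∷ true ∷ []

candidates : (n : ℕ) → List (Vec (Fin n) n × Vec Bool n)
candidates n = L.cartesianProduct (allVecs (L.allFin n) n) (allVecs allBools n)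

count : ℕ → ℕ
count n = length (filter good? (candidates n))

catalan : ℕ → ℕ
catalan m = ((2 * m) C m) / suc m

-- Bi-avoiding (1-2, 0 0) and (1-2, 0 1) says exactly that every ascent σᵢ < σⱼ (i < j) carries
-- the signs wᵢ = 1, wⱼ = 0. Refine the count by a threshold t, demanding sign 0 on every value ≥ t,
-- and let c(k, t) be the refined count in size k. Remove the first letter x of σ: with sign 0, x
-- exceeds every later letter, so it is the maximum; with sign 1, x < t and every later letter above
-- x has sign 0, i.e. the rest obeys threshold x. Hence
--   c(k + 1, t) = Σ_{x ≤ k, x < t} c(k, x) + c(k, t),
-- the ballot recursion, solved by c(k, t) = C(k+1+t, t) − C(k+1+t, t−1). The count in question is
-- c(n, n) = C(2n+1, n) − C(2n+1, n−1) = C(2n+2, n+1)/(n+2).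

module Submission where

open import Defs
open import Data.Nat using (ℕ; zero; suc; _+_; _*_; _≤_; _<_; s≤s; s≤s⁻¹; z<s; _≤?_; _<?_; _≟_)
open import Data.Nat.Properties
open import Data.Nat.DivMod using (_/_; m*n/n≡m)
open import Data.Nat.Combinatorics using (_C_; nCk+nC[k+1]≡[n+1]C[k+1])
open import Data.Nat.Tactic.RingSolver using (solve-∀)
open import Data.Fin using (Fin; zero; suc; toℕ; punchIn; fromℕ<)
import Data.Fin as F
import Data.Fin.Properties as FP
open import Data.Bool using (Bool; true; false; if_then_else_)
open import Data.Bool.Properties using () renaming (_≟_ to _≟B_)
open import Data.Vec using (Vec; _∷_; lookup)
import Data.Vec as V
open import Data.Vec.Properties using (lookup-map)
open import Data.List
  using (List; []; _∷_; _++_; length; filter; concatMap; tabulate; allFin; cartesianProduct)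
import Data.List as L
open import Data.Product using (_×_; _,_; proj₁; proj₂)
open import Data.Sum using (inj₁; inj₂)
open import Data.Empty using (⊥-elim)
open import Function using (_∘_; _⇔_; mk⇔; Equivalence)
open import Function.Definitions using (Injective)
open import Relation.Nullary using (¬_; Dec; yes; no; does)
open import Relation.Nullary.Decidable using (_×-dec_; _→-dec_)
import Relation.Nullary.Decidable as Dec
open import Relation.Unary using (Pred; Decidable)
open import Level using (Level)
open import Relation.Binary.PropositionalEquality
open import Algebra.Properties.CommutativeSemigroup +-commutativeSemigroup
  using () renaming (interchange to +-interchange)
open import Algebra.Properties.Semiring.Sum +-*-semiring
  using (sum; sum-syntax; sum-cong-≗; sum-remove; ∑-distrib-+; sum-replicate-zero)

open Equivalence using (to; from)

private
  variable
    p q r : Level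
    A B : Set
    P : Set p
    Q : Set q
    R : Set r

-- Defined through `does` alone, so that e.g. χ (suc m <? suc t) and χ (m <? t) are
-- definitionally equal.
χ : Dec P → ℕ
χ P? = if does P? then 1 else 0

χ-yes : P → (P? : Dec P) → χ P? ≡ 1
χ-yes p (yes _) = refl
χ-yes p (no ¬p) = ⊥-elim (¬p p)

χ-no : ¬ P → (P? : Dec P) → χ P? ≡ 0
χ-no ¬p (yes p) = ⊥-elim (¬p p)
χ-no ¬p (no _)  = refl

χ-cong : P ⇔ Q → (P? : Dec P) (Q? : Dec Q) → χ P? ≡ χ Q?
χ-cong P⇔Q P? (yes q) = χ-yes (from P⇔Q q) P?
χ-cong P⇔Q P? (no ¬q) = χ-no (¬q ∘ to P⇔Q) P?

χ-× : P ⇔ (Q × R) → (P? : Dec P) (Q? : Dec Q) (R? : Dec R) → χ P? ≡ χ Q? * χ R?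
χ-× P⇔Q×R P? (yes q) (yes r) = χ-yes (from P⇔Q×R (q , r)) P?
χ-× P⇔Q×R P? (yes q) (no ¬r) = χ-no (¬r ∘ proj₂ ∘ to P⇔Q×R) P?
χ-× P⇔Q×R P? (no ¬q) R?      = χ-no (¬q ∘ proj₁ ∘ to P⇔Q×R) P?

infix 10 listSum

listSum : List A → (A → ℕ) → ℕ
listSum []       f = 0
listSum (x ∷ xs) f = f x + listSum xs f

syntax listSum xs (λ x → e) = ∑[ x ∈ xs ] e

∑ˡ-cong : (xs : List A) {f g : A → ℕ} → (∀ x → f x ≡ g x) → ∑[ x ∈ xs ] f x ≡ ∑[ x ∈ xs ] g x
∑ˡ-cong []       f≗g = refl
∑ˡ-cong (x ∷ xs) f≗g = cong₂ _+_ (f≗g x) (∑ˡ-cong xs f≗g)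

∑ˡ-zero : (xs : List A) {f : A → ℕ} → (∀ x → f x ≡ 0) → ∑[ x ∈ xs ] f x ≡ 0
∑ˡ-zero []       f≗0 = refl
∑ˡ-zero (x ∷ xs) f≗0 = cong₂ _+_ (f≗0 x) (∑ˡ-zero xs f≗0)

∑ˡ-++ : (xs ys : List A) (f : A → ℕ) → ∑[ x ∈ xs ++ ys ] f x ≡ ∑[ x ∈ xs ] f x + ∑[ y ∈ ys ] f y
∑ˡ-++ []       ys f = refl
∑ˡ-++ (x ∷ xs) ys f = trans (cong (f x +_) (∑ˡ-++ xs ys f)) (sym (+-assoc (f x) _ _))

∑ˡ-distrib-+ : (xs : List A) (f g : A → ℕ) →
               ∑[ x ∈ xs ] (f x + g x) ≡ ∑[ x ∈ xs ] f x + ∑[ x ∈ xs ] g x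
∑ˡ-distrib-+ []       f g = refl
∑ˡ-distrib-+ (x ∷ xs) f g =
  trans (cong (f x + g x +_) (∑ˡ-distrib-+ xs f g)) (+-interchange (f x) (g x) _ _)

*-distribˡ-∑ˡ : (c : ℕ) (xs : List A) (f : A → ℕ) → c * ∑[ x ∈ xs ] f x ≡ ∑[ x ∈ xs ] (c * f x)
*-distribˡ-∑ˡ c []       f = *-zeroʳ c
*-distribˡ-∑ˡ c (x ∷ xs) f =
  trans (*-distribˡ-+ c (f x) _) (cong (c * f x +_) (*-distribˡ-∑ˡ c xs f))

∑ˡ-map : (h : A → B) (xs : List A) (f : B → ℕ) → ∑[ y ∈ L.map h xs ] f y ≡ ∑[ x ∈ xs ] f (h x)
∑ˡ-map h []       f = refl
∑ˡ-map h (x ∷ xs) f = cong (f (h x) +_) (∑ˡ-map h xs f)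

∑ˡ-concatMap : (h : A → List B) (xs : List A) (f : B → ℕ) →
               ∑[ y ∈ concatMap h xs ] f y ≡ ∑[ x ∈ xs ] ∑[ y ∈ h x ] f y
∑ˡ-concatMap h []       f = refl
∑ˡ-concatMap h (x ∷ xs) f =
  trans (∑ˡ-++ (h x) (concatMap h xs) f) (cong (_ +_) (∑ˡ-concatMap h xs f))

∑ˡ-cartesianProduct : (xs : List A) (ys : List B) (f : A × B → ℕ) →
                      ∑[ p ∈ cartesianProduct xs ys ] f p ≡ ∑[ x ∈ xs ] ∑[ y ∈ ys ] f (x , y)
∑ˡ-cartesianProduct []       ys f = refl
∑ˡ-cartesianProduct (x ∷ xs) ys f =
  trans (∑ˡ-++ (L.map (x ,_) ys) _ f) (cong₂ _+_ (∑ˡ-map (x ,_) ys f) (∑ˡ-cartesianProduct xs ys f))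

∑ˡ-tabulate : ∀ n (g : Fin n → A) (f : A → ℕ) → ∑[ x ∈ tabulate g ] f x ≡ ∑[ i < n ] f (g i)
∑ˡ-tabulate zero    g f = refl
∑ˡ-tabulate (suc n) g f = cong (f (g zero) +_) (∑ˡ-tabulate n (g ∘ suc) f)

length-filter : ∀ {ℓ} {U : Pred A ℓ} (U? : Decidable U) (xs : List A) →
                length (filter U? xs) ≡ ∑[ x ∈ xs ] χ (U? x)
length-filter U? []       = refl
length-filter U? (x ∷ xs) with does (U? x)
... | true  = cong suc (length-filter U? xs)
... | false = length-filter U? xs

∑ˡ-allVecs-suc : (xs : List A) (j : ℕ) (g : Vec A (suc j) → ℕ) →
                 ∑[ v ∈ allVecs xs (suc j) ] g v ≡ ∑[ y ∈ xs ] ∑[ v ∈ allVecs xs j ] g (y ∷ v)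
∑ˡ-allVecs-suc xs j g = trans (∑ˡ-concatMap (λ y → L.map (y ∷_) (allVecs xs j)) xs g)
                              (∑ˡ-cong xs (λ y → ∑ˡ-map (y ∷_) (allVecs xs j) g))

χ-<-suc : ∀ m t → χ (m <? suc t) ≡ χ (m <? t) + χ (m ≟ t)
χ-<-suc zero    zero    = refl
χ-<-suc zero    (suc t) = refl
χ-<-suc (suc m) zero    = refl
χ-<-suc (suc m) (suc t) = χ-<-suc m t

∑-δ : ∀ {n} t → t < n → (f : ℕ → ℕ) → ∑[ i < n ] (χ (toℕ i ≟ t) * f (toℕ i)) ≡ f t
∑-δ {suc n} zero    _         f = trans (cong₂ _+_ (*-identityˡ (f 0)) (sum-replicate-zero n)) (+-identityʳ (f 0))
∑-δ {suc n} (suc t) (s≤s t<n) f = ∑-δ t t<n (f ∘ suc)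

∑-<-suc : ∀ {n} t → t < n → (f : ℕ → ℕ) →
          ∑[ i < n ] (χ (toℕ i <? suc t) * f (toℕ i)) ≡ ∑[ i < n ] (χ (toℕ i <? t) * f (toℕ i)) + f t
∑-<-suc {n} t t<n f = begin
  ∑[ i < n ] (χ (toℕ i <? suc t) * f (toℕ i))  ≡⟨ sum-cong-≗ {n} split ⟩
  ∑[ i < n ] (below i + at i)                  ≡⟨ ∑-distrib-+ below at ⟩
  ∑[ i < n ] below i + ∑[ i < n ] at i         ≡⟨ cong (∑[ i < n ] below i +_) (∑-δ t t<n f) ⟩
  ∑[ i < n ] below i + f t                     ∎
  where
  open ≡-Reasoning
  below at : Fin n → ℕ
  below i = χ (toℕ i <? t) * f (toℕ i)
  at    i = χ (toℕ i ≟ t) * f (toℕ i)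
  split : ∀ i → χ (toℕ i <? suc t) * f (toℕ i) ≡ below i + at i
  split i = trans (cong (_* f (toℕ i)) (χ-<-suc (toℕ i) t))
                  (*-distribʳ-+ (f (toℕ i)) (χ (toℕ i <? t)) (χ (toℕ i ≟ t)))

∑ˡ-allVecs-punchIn : ∀ {k} j (x : Fin (suc k)) (g : Vec (Fin (suc k)) j → ℕ) →
                     (∀ v i → lookup v i ≡ x → g v ≡ 0) →
                     ∑[ v ∈ allVecs (allFin (suc k)) j ] g v
                       ≡ ∑[ u ∈ allVecs (allFin k) j ] g (V.map (punchIn x) u)
∑ˡ-allVecs-punchIn         zero    x g g-x≡0 = refl
∑ˡ-allVecs-punchIn {k} (suc j) x g g-x≡0 = begin
  ∑[ v ∈ allVecs (allFin (suc k)) (suc j) ] g v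
    ≡⟨ ∑ˡ-allVecs-suc (allFin (suc k)) j g ⟩
  ∑[ y ∈ allFin (suc k) ] G y
    ≡⟨ ∑ˡ-tabulate (suc k) (λ y → y) G ⟩
  ∑[ y < suc k ] G y
    ≡⟨ sum-remove {i = x} G ⟩
  G x + ∑[ y < k ] G (punchIn x y)
    ≡⟨ cong (_+ ∑[ y < k ] G (punchIn x y)) (∑ˡ-zero (allVecs (allFin (suc k)) j) (λ v → g-x≡0 (x ∷ v) zero refl))
     ⟩
  ∑[ y < k ] G (punchIn x y)
    ≡⟨ sum-cong-≗ {k} (λ y → ∑ˡ-allVecs-punchIn j x (g ∘ (punchIn x y ∷_))
                                 (λ v i → g-x≡0 (punchIn x y ∷ v) (suc i))) ⟩
  ∑[ y < k ] ∑[ u ∈ allVecs (allFin k) j ] g (V.map (punchIn x) (y ∷ u))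
    ≡⟨ ∑ˡ-tabulate k (λ y → y) _ ⟨
  ∑[ y ∈ allFin k ] ∑[ u ∈ allVecs (allFin k) j ] g (V.map (punchIn x) (y ∷ u))
    ≡⟨ ∑ˡ-allVecs-suc (allFin k) j (g ∘ V.map (punchIn x)) ⟨
  ∑[ u ∈ allVecs (allFin k) (suc j) ] g (V.map (punchIn x) u) ∎
  where
  open ≡-Reasoning
  G : Fin (suc k) → ℕ
  G y = ∑[ v ∈ allVecs (allFin (suc k)) j ] g (y ∷ v)

toℕ-punchIn-< : ∀ {k} (x : Fin (suc k)) (y : Fin k) → toℕ y < toℕ x → toℕ (punchIn x y) ≡ toℕ y
toℕ-punchIn-< (suc x) zero    _         = refl
toℕ-punchIn-< (suc x) (suc y) (s≤s y<x) = cong suc (toℕ-punchIn-< x y y<x)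

toℕ-punchIn-≥ : ∀ {k} (x : Fin (suc k)) (y : Fin k) → toℕ x ≤ toℕ y → toℕ (punchIn x y) ≡ suc (toℕ y)
toℕ-punchIn-≥ zero    y       _         = refl
toℕ-punchIn-≥ (suc x) (suc y) (s≤s x≤y) = cong suc (toℕ-punchIn-≥ x y x≤y)

punchIn-mono-< : ∀ {k} (x : Fin (suc k)) {y z : Fin k} → y F.< z → punchIn x y F.< punchIn x z
punchIn-mono-< x {y} {z} y<z = ≰⇒> (<⇒≱ y<z ∘ FP.punchIn-cancel-≤ x z y)

punchIn-cancel-< : ∀ {k} (x : Fin (suc k)) {y z : Fin k} → punchIn x y F.< punchIn x z → y F.< z
punchIn-cancel-< x {y} {z} y<z = ≰⇒> (<⇒≱ y<z ∘ FP.punchIn-mono-≤ x z y)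

<-punchIn⇔ : ∀ {k} (x : Fin (suc k)) (y : Fin k) → x F.< punchIn x y ⇔ toℕ x ≤ toℕ y
<-punchIn⇔ x y = mk⇔ (λ x<y′ → ≮⇒≥ (λ y<x → <-irrefl (sym (toℕ-punchIn-< x y y<x)) (<-trans y<x x<y′)))
                     (λ x≤y → subst (toℕ x <_) (sym (toℕ-punchIn-≥ x y x≤y)) (s≤s x≤y))

injective⇒≤ : ∀ {k b} (f : Fin k → ℕ) → Injective _≡_ _≡_ f → (∀ i → f i < b) → k ≤ b
injective⇒≤ {k} {b} f f-inj f<b = ≮⇒≥ collision
  where
  collision : ¬ b < k
  collision b<k with FP.pigeonhole b<k (λ i → fromℕ< (f<b i))
  ... | i , j , i<j , same = <-irrefl (cong toℕ (f-inj (FP.fromℕ<-injective _ _ (f<b i) (f<b j) same))) i<j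

Ascents10 : ∀ {n} → Vec (Fin n) n → Vec Bool n → Set
Ascents10 {n} σ w = ∀ i j → i F.< j → lookup σ i F.< lookup σ j → lookup w i ≡ true × lookup w j ≡ false

ZeroFrom : ∀ {n} → ℕ → Vec (Fin n) n → Vec Bool n → Set
ZeroFrom {n} t σ w = ∀ i → t ≤ toℕ (lookup σ i) → lookup w i ≡ false

GoodFrom : ∀ {n} → ℕ → Vec (Fin n) n × Vec Bool n → Set
GoodFrom t (σ , w) = (IsPerm σ × Ascents10 σ w) × ZeroFrom t σ w

true≢false : true ≢ false
true≢false ()

avoids-00-01⇔10 : (a b : Bool) → (a ≢ b × ¬ (a ≡ false × b ≡ true)) ⇔ (a ≡ true × b ≡ false)
avoids-00-01⇔10 a b = mk⇔ (to′ a b) (from′ a b)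
  where
  to′ : ∀ a b → a ≢ b × ¬ (a ≡ false × b ≡ true) → a ≡ true × b ≡ false
  to′ false false (a≢b , _)   = ⊥-elim (a≢b refl)
  to′ false true  (_   , ¬01) = ⊥-elim (¬01 (refl , refl))
  to′ true  false _           = refl , refl
  to′ true  true  (a≢b , _)   = ⊥-elim (a≢b refl)
  from′ : ∀ a b → a ≡ true × b ≡ false → a ≢ b × ¬ (a ≡ false × b ≡ true)
  from′ true false _ = (λ ()) , (λ ())

good⇔ : ∀ {n} (σ : Vec (Fin n) n) w → Good (σ , w) ⇔ (IsPerm σ × Ascents10 σ w)
good⇔ σ w = mk⇔
  (λ (perm , av00 , av01) → perm , λ i j i<j ↑ → to (avoids-00-01⇔10 _ _) (av00 i j i<j ↑ , av01 i j i<j ↑))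
  (λ (perm , asc) → perm , (λ i j i<j ↑ → proj₁ (from (avoids-00-01⇔10 _ _) (asc i j i<j ↑)))
                         , (λ i j i<j ↑ → proj₂ (from (avoids-00-01⇔10 _ _) (asc i j i<j ↑))))

zeroFrom? : ∀ {n} t (σ : Vec (Fin n) n) w → Dec (ZeroFrom t σ w)
zeroFrom? t σ w = FP.all? (λ i → (t ≤? toℕ (lookup σ i)) →-dec (lookup w i ≟B false))

goodFrom? : ∀ {n} t (p : Vec (Fin n) n × Vec Bool n) → Dec (GoodFrom t p)
goodFrom? t (σ , w) = Dec.map (good⇔ σ w) (good? (σ , w)) ×-dec zeroFrom? t σ w

signings : ∀ {k} → ℕ → Vec (Fin k) k → ℕ
signings {k} t σ = ∑[ w ∈ allVecs allBools k ] χ (goodFrom? t (σ , w))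

countFrom : ℕ → ℕ → ℕ
countFrom k t = ∑[ σ ∈ allVecs (allFin k) k ] signings t σ

count≡countFrom : ∀ n → count n ≡ countFrom n n
count≡countFrom n = begin
  count n
    ≡⟨ length-filter good? (candidates n) ⟩
  ∑[ p ∈ candidates n ] χ (good? p)
    ≡⟨ ∑ˡ-cartesianProduct (allVecs (allFin n) n) (allVecs allBools n) (χ ∘ good?) ⟩
  ∑[ σ ∈ allVecs (allFin n) n ] ∑[ w ∈ allVecs allBools n ] χ (good? (σ , w))
    ≡⟨ ∑ˡ-cong (allVecs (allFin n) n) (λ σ → ∑ˡ-cong (allVecs allBools n)
         (λ w → χ-cong (good⇔goodFrom σ w) (good? (σ , w)) (goodFrom? n (σ , w)))) ⟩
  countFrom n n ∎
  where
  open ≡-Reasoning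
  good⇔goodFrom : ∀ σ w → Good (σ , w) ⇔ GoodFrom n (σ , w)
  good⇔goodFrom σ w = mk⇔ (λ good → to (good⇔ σ w) good
                                  , λ i n≤σᵢ → ⊥-elim (<⇒≱ (FP.toℕ<n (lookup σ i)) n≤σᵢ))
                          (from (good⇔ σ w) ∘ proj₁)

module FirstLetter {k : ℕ} (x : Fin (suc k)) (u : Vec (Fin k) k) where

  σ : Vec (Fin (suc k)) (suc k)
  σ = x ∷ V.map (punchIn x) u

  lookup-σ : ∀ j → lookup σ (suc j) ≡ punchIn x (lookup u j)
  lookup-σ j = lookup-map j (punchIn x) u

  x<σ⇔ : ∀ j → x F.< lookup σ (suc j) ⇔ toℕ x ≤ toℕ (lookup u j)
  x<σ⇔ j = subst (λ y → (x F.< y) ⇔ (toℕ x ≤ toℕ (lookup u j)))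
                 (sym (lookup-σ j)) (<-punchIn⇔ x (lookup u j))

  toℕ-σ-below : ∀ j → toℕ (lookup u j) < toℕ x → toℕ (lookup σ (suc j)) ≡ toℕ (lookup u j)
  toℕ-σ-below j u<x = trans (cong toℕ (lookup-σ j)) (toℕ-punchIn-< x (lookup u j) u<x)

  isPerm⇔ : IsPerm σ ⇔ IsPerm u
  isPerm⇔ = mk⇔ to′ from′
    where
    to′ : IsPerm σ → IsPerm u
    to′ perm i j e = FP.suc-injective (perm (suc i) (suc j)
      (trans (lookup-σ i) (trans (cong (punchIn x) e) (sym (lookup-σ j)))))
    from′ : IsPerm u → IsPerm σ
    from′ perm zero    zero    _ = refl
    from′ perm zero    (suc j) e = ⊥-elim (FP.punchInᵢ≢i x (lookup u j) (sym (trans e (lookup-σ j))))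
    from′ perm (suc i) zero    e = ⊥-elim (FP.punchInᵢ≢i x (lookup u i) (trans (sym (lookup-σ i)) e))
    from′ perm (suc i) (suc j) e =
      cong suc (perm i j (FP.punchIn-injective x _ _ (trans (sym (lookup-σ i)) (trans e (lookup-σ j)))))

  LeadingAscents : Bool → Vec Bool k → Set
  LeadingAscents b w = ∀ j → toℕ x ≤ toℕ (lookup u j) → b ≡ true × lookup w j ≡ false

  ascents10⇔ : ∀ b w → Ascents10 σ (b ∷ w) ⇔ (LeadingAscents b w × Ascents10 u w)
  ascents10⇔ b w = mk⇔ to′ from′
    where
    to′ : Ascents10 σ (b ∷ w) → LeadingAscents b w × Ascents10 u w
    to′ asc = (λ j x≤u → asc zero (suc j) z<s (from (x<σ⇔ j) x≤u))
            , (λ i j i<j u<u → asc (suc i) (suc j) (s≤s i<j)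
                 (subst₂ F._<_ (sym (lookup-σ i)) (sym (lookup-σ j)) (punchIn-mono-< x u<u)))
    from′ : LeadingAscents b w × Ascents10 u w → Ascents10 σ (b ∷ w)
    from′ (lead , asc) zero    (suc j) _         x<σ = lead j (to (x<σ⇔ j) x<σ)
    from′ (lead , asc) (suc i) (suc j) (s≤s i<j) σ<σ =
      asc i j i<j (punchIn-cancel-< x (subst₂ F._<_ (lookup-σ i) (lookup-σ j) σ<σ))

  below⇔ : IsPerm u → (∀ j → toℕ (lookup u j) < toℕ x) ⇔ (toℕ x ≡ k)
  below⇔ perm = mk⇔
    (λ below → ≤-antisym (s≤s⁻¹ (FP.toℕ<n x))
                         (injective⇒≤ (toℕ ∘ lookup u) (perm _ _ ∘ FP.toℕ-injective) below))
    (λ x≡k j → subst (toℕ (lookup u j) <_) (sym x≡k) (FP.toℕ<n (lookup u j)))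

  goodFrom-true⇔ : ∀ t w → GoodFrom t (σ , true ∷ w) ⇔ (toℕ x < t × GoodFrom (toℕ x) (u , w))
  goodFrom-true⇔ t w = mk⇔ to′ from′
    where
    to′ : GoodFrom t (σ , true ∷ w) → toℕ x < t × GoodFrom (toℕ x) (u , w)
    to′ ((perm , asc) , zero-t) with to (ascents10⇔ true w) asc
    ... | lead , asc′ = ≰⇒> (λ t≤x → true≢false (zero-t zero t≤x))
                      , (to isPerm⇔ perm , asc′) , (λ j x≤u → proj₂ (lead j x≤u))
    from′ : toℕ x < t × GoodFrom (toℕ x) (u , w) → GoodFrom t (σ , true ∷ w)
    from′ (x<t , (perm , asc) , zero-x) =
      (from isPerm⇔ perm , from (ascents10⇔ true w) ((λ j x≤u → refl , zero-x j x≤u) , asc)) , zero-t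
      where
      zero-t : ZeroFrom t σ (true ∷ w)
      zero-t zero    t≤x = ⊥-elim (<⇒≱ x<t t≤x)
      zero-t (suc j) t≤σ = zero-x j (to (x<σ⇔ j) (<-≤-trans x<t t≤σ))

  goodFrom-false⇔ : ∀ t w → GoodFrom t (σ , false ∷ w) ⇔ (toℕ x ≡ k × GoodFrom t (u , w))
  goodFrom-false⇔ t w = mk⇔ to′ from′
    where
    to′ : GoodFrom t (σ , false ∷ w) → toℕ x ≡ k × GoodFrom t (u , w)
    to′ ((perm , asc) , zero-t) with to isPerm⇔ perm | to (ascents10⇔ false w) asc
    ... | perm′ | lead , asc′ = to (below⇔ perm′) below , (perm′ , asc′)
                              , (λ j t≤u → zero-t (suc j) (subst (t ≤_) (sym (toℕ-σ-below j (below j))) t≤u))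
      where
      below : ∀ j → toℕ (lookup u j) < toℕ x
      below j = ≰⇒> (λ x≤u → true≢false (sym (proj₁ (lead j x≤u))))
    from′ : toℕ x ≡ k × GoodFrom t (u , w) → GoodFrom t (σ , false ∷ w)
    from′ (x≡k , (perm , asc) , zero-t) =
      (from isPerm⇔ perm , from (ascents10⇔ false w) (lead , asc)) , zero-t′
      where
      below : ∀ j → toℕ (lookup u j) < toℕ x
      below = from (below⇔ perm) x≡k
      lead : LeadingAscents false w
      lead j x≤u = ⊥-elim (<⇒≱ (below j) x≤u)
      zero-t′ : ZeroFrom t σ (false ∷ w)
      zero-t′ zero    _   = refl
      zero-t′ (suc j) t≤σ = zero-t j (subst (t ≤_) (toℕ-σ-below j (below j)) t≤σ)

  signings-∷ : ∀ t → signings t σ ≡ χ (toℕ x ≟ k) * signings t u + χ (toℕ x <? t) * signings (toℕ x) u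
  signings-∷ t = begin
    signings t σ
      ≡⟨ ∑ˡ-allVecs-suc allBools k (λ w → χ (goodFrom? t (σ , w))) ⟩
    ∑[ w ∈ W ] χ (goodFrom? t (σ , false ∷ w)) + (∑[ w ∈ W ] χ (goodFrom? t (σ , true ∷ w)) + 0)
      ≡⟨ cong₂ _+_ (∑ˡ-cong W lead0) (trans (+-identityʳ _) (∑ˡ-cong W lead1)) ⟩
    ∑[ w ∈ W ] (χ (toℕ x ≟ k) * χ (goodFrom? t (u , w)))
      + ∑[ w ∈ W ] (χ (toℕ x <? t) * χ (goodFrom? (toℕ x) (u , w)))
      ≡⟨ cong₂ _+_ (*-distribˡ-∑ˡ (χ (toℕ x ≟ k)) W (λ w → χ (goodFrom? t (u , w))))
                   (*-distribˡ-∑ˡ (χ (toℕ x <? t)) W (λ w → χ (goodFrom? (toℕ x) (u , w)))) ⟨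
    χ (toℕ x ≟ k) * signings t u + χ (toℕ x <? t) * signings (toℕ x) u ∎
    where
    open ≡-Reasoning
    W = allVecs allBools k
    lead0 : ∀ w → χ (goodFrom? t (σ , false ∷ w)) ≡ χ (toℕ x ≟ k) * χ (goodFrom? t (u , w))
    lead0 w = χ-× (goodFrom-false⇔ t w) (goodFrom? t (σ , false ∷ w)) (toℕ x ≟ k) (goodFrom? t (u , w))
    lead1 : ∀ w → χ (goodFrom? t (σ , true ∷ w)) ≡ χ (toℕ x <? t) * χ (goodFrom? (toℕ x) (u , w))
    lead1 w = χ-× (goodFrom-true⇔ t w) (goodFrom? t (σ , true ∷ w)) (toℕ x <? t) (goodFrom? (toℕ x) (u , w))

signings-repeat : ∀ {k} t (x : Fin (suc k)) (v : Vec (Fin (suc k)) k) i →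
                  lookup v i ≡ x → signings t (x ∷ v) ≡ 0
signings-repeat t x v i vᵢ≡x =
  ∑ˡ-zero (allVecs allBools _) (λ w → χ-no (not-perm ∘ proj₁ ∘ proj₁) (goodFrom? t (x ∷ v , w)))
  where
  not-perm : ¬ IsPerm (x ∷ v)
  not-perm perm with perm zero (suc i) (sym vᵢ≡x)
  ... | ()

countFrom-suc : ∀ k t →
                countFrom (suc k) t ≡ ∑[ x < suc k ] (χ (toℕ x <? t) * countFrom k (toℕ x)) + countFrom k t
countFrom-suc k t = begin
  countFrom (suc k) t
    ≡⟨ ∑ˡ-allVecs-suc (allFin (suc k)) k (signings t) ⟩
  ∑[ x ∈ allFin (suc k) ] ∑[ v ∈ allVecs (allFin (suc k)) k ] signings t (x ∷ v)
    ≡⟨ ∑ˡ-tabulate (suc k) (λ x → x) _ ⟩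
  ∑[ x < suc k ] ∑[ v ∈ allVecs (allFin (suc k)) k ] signings t (x ∷ v)
    ≡⟨ sum-cong-≗ {suc k} (λ x → ∑ˡ-allVecs-punchIn k x (signings t ∘ (x ∷_)) (signings-repeat t x)) ⟩
  ∑[ x < suc k ] ∑[ u ∈ U ] signings t (x ∷ V.map (punchIn x) u)
    ≡⟨ sum-cong-≗ {suc k} by-first-letter ⟩
  ∑[ x < suc k ] (top x + lower x)
    ≡⟨ ∑-distrib-+ top lower ⟩
  ∑[ x < suc k ] top x + ∑[ x < suc k ] lower x
    ≡⟨ cong (_+ ∑[ x < suc k ] lower x) (∑-δ k (n<1+n k) (λ _ → countFrom k t)) ⟩
  countFrom k t + ∑[ x < suc k ] lower x
    ≡⟨ +-comm (countFrom k t) _ ⟩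
  ∑[ x < suc k ] lower x + countFrom k t ∎
  where
  open ≡-Reasoning
  U = allVecs (allFin k) k
  top lower : Fin (suc k) → ℕ
  top   x = χ (toℕ x ≟ k) * countFrom k t
  lower x = χ (toℕ x <? t) * countFrom k (toℕ x)
  by-first-letter : ∀ x → ∑[ u ∈ U ] signings t (x ∷ V.map (punchIn x) u) ≡ top x + lower x
  by-first-letter x = begin
    ∑[ u ∈ U ] signings t (x ∷ V.map (punchIn x) u)
      ≡⟨ ∑ˡ-cong U (λ u → FirstLetter.signings-∷ x u t) ⟩
    ∑[ u ∈ U ] (χ (toℕ x ≟ k) * signings t u + χ (toℕ x <? t) * signings (toℕ x) u)
      ≡⟨ ∑ˡ-distrib-+ U _ _ ⟩
    ∑[ u ∈ U ] (χ (toℕ x ≟ k) * signings t u) + ∑[ u ∈ U ] (χ (toℕ x <? t) * signings (toℕ x) u)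
      ≡⟨ cong₂ _+_ (*-distribˡ-∑ˡ (χ (toℕ x ≟ k)) U (signings t))
                   (*-distribˡ-∑ˡ (χ (toℕ x <? t)) U (signings (toℕ x))) ⟨
    top x + lower x ∎

ballot : ℕ → ℕ → ℕ
ballot zero    t = 1
ballot (suc k) t = ∑[ x < suc k ] (χ (toℕ x <? t) * ballot k (toℕ x)) + ballot k t

countFrom≡ballot : ∀ k t → countFrom k t ≡ ballot k t
countFrom≡ballot zero    t = refl
countFrom≡ballot (suc k) t = trans (countFrom-suc k t) (cong₂ _+_
  (sum-cong-≗ {suc k} (λ x → cong (χ (toℕ x <? t) *_) (countFrom≡ballot k (toℕ x))))
  (countFrom≡ballot k t))

ballot-zeroʳ : ∀ k → ballot k 0 ≡ 1
ballot-zeroʳ zero    = refl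
ballot-zeroʳ (suc k) = cong₂ _+_ (sum-replicate-zero (suc k)) (ballot-zeroʳ k)

ballot-pascal : ∀ k t → t ≤ k → ballot (suc k) (suc t) ≡ ballot (suc k) t + ballot k (suc t)
ballot-pascal k t t≤k = cong (_+ ballot k (suc t)) (∑-<-suc t (s≤s t≤k) (ballot k))

ballot-saturated : ∀ k t → k ≤ t → ballot k t ≡ ballot k k
ballot-saturated zero    t _   = refl
ballot-saturated (suc k) t k<t = cong₂ _+_
  (sum-cong-≗ {suc k} (λ x → cong (_* ballot k (toℕ x))
    (trans (χ-yes (<-≤-trans (FP.toℕ<n x) k<t) (toℕ x <? t)) (sym (χ-yes (FP.toℕ<n x) (toℕ x <? suc k))))))
  (trans (ballot-saturated k t (≤-trans (n≤1+n k) k<t)) (sym (ballot-saturated k (suc k) (n≤1+n k))))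

binom : ℕ → ℕ → ℕ
binom n       zero    = 1
binom zero    (suc k) = 0
binom (suc n) (suc k) = binom n k + binom n (suc k)

C≡binom : ∀ n k → n C k ≡ binom n k
C≡binom n       zero    = refl
C≡binom zero    (suc k) = refl
C≡binom (suc n) (suc k) = trans (sym (nCk+nC[k+1]≡[n+1]C[k+1] n k)) (cong₂ _+_ (C≡binom n k) (C≡binom n (suc k)))

binomPred : ℕ → ℕ → ℕ
binomPred n zero    = 0
binomPred n (suc k) = binom n k

binom-suc : ∀ n k → binom (suc n) k ≡ binomPred n k + binom n k
binom-suc n zero    = refl
binom-suc n (suc k) = refl

-- (k + 1) C(n, k + 1) = (n - k) C(n, k), with the subtraction moved to the left.
binom-absorb : ∀ n k → suc k * binom n (suc k) + k * binom n k ≡ n * binom n k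
binom-absorb zero    zero    = refl
binom-absorb zero    (suc k) = cong₂ _+_ (*-zeroʳ (2 + k)) (*-zeroʳ (suc k))
binom-absorb (suc n) zero    =
  trans (+-identityʳ _) (trans (*-identityˡ _) (trans (binom-one n) (sym (*-identityʳ (suc n)))))
  where
  binom-one : ∀ n → binom (suc n) 1 ≡ suc n
  binom-one zero    = refl
  binom-one (suc n) = cong suc (binom-one n)
binom-absorb (suc n) (suc k) = begin
  (2 + k) * (b + c) + (1 + k) * (a + b)
    ≡⟨ regroup k a b c ⟩
  ((2 + k) * c + (1 + k) * b) + ((1 + k) * b + k * a) + (a + b)
    ≡⟨ cong₂ (λ x y → x + y + (a + b)) (binom-absorb n (suc k)) (binom-absorb n k) ⟩
  n * b + n * a + (a + b)
    ≡⟨ collect n a b ⟩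
  (1 + n) * (a + b) ∎
  where
  open ≡-Reasoning
  a = binom n k
  b = binom n (suc k)
  c = binom n (2 + k)
  regroup : ∀ k a b c → (2 + k) * (b + c) + (1 + k) * (a + b)
                        ≡ ((2 + k) * c + (1 + k) * b) + ((1 + k) * b + k * a) + (a + b)
  regroup = solve-∀
  collect : ∀ n a b → n * b + n * a + (a + b) ≡ (1 + n) * (a + b)
  collect = solve-∀

binom-central : ∀ k → binom (suc k + k) (suc k) ≡ binom (suc k + k) k
binom-central k = *-cancelˡ-≡ _ _ (suc k) (+-cancelʳ-≡ (k * binom n k) _ _ (begin
  suc k * binom n (suc k) + k * binom n k  ≡⟨ binom-absorb n k ⟩
  n * binom n k                            ≡⟨ *-distribʳ-+ (binom n k) (suc k) k ⟩
  suc k * binom n k + k * binom n k        ∎))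
  where
  open ≡-Reasoning
  n = suc k + k

BallotFormula : ℕ → ℕ → Set
BallotFormula k t = ballot k t + binomPred (suc (t + k)) t ≡ binom (suc (t + k)) t

ballot-formula-diagonal : ∀ k → BallotFormula k k → BallotFormula k (suc k)
ballot-formula-diagonal k formula = begin
  ballot k (suc k) + binom (suc n) k     ≡⟨ cong₂ _+_ (ballot-saturated k (suc k) (n≤1+n k)) (binom-suc n k) ⟩
  ballot k k + (binomPred n k + binom n k) ≡⟨ +-assoc (ballot k k) _ _ ⟨
  ballot k k + binomPred n k + binom n k ≡⟨ cong (_+ binom n k) formula ⟩
  binom n k + binom n k                  ≡⟨ cong (binom n k +_) (binom-central k) ⟨
  binom n k + binom n (suc k)            ∎
  where
  open ≡-Reasoning
  n = suc (k + k)

ballot-formula-step : ∀ k t → t ≤ k →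
                      BallotFormula (suc k) t → BallotFormula k (suc t) → BallotFormula (suc k) (suc t)
ballot-formula-step k t t≤k formula₁ formula₂ = begin
  ballot (suc k) (suc t) + binom (suc n) t
    ≡⟨ cong₂ _+_ (ballot-pascal k t t≤k) (binom-suc n t) ⟩
  (ballot (suc k) t + ballot k (suc t)) + (binomPred n t + binom n t)
    ≡⟨ +-interchange (ballot (suc k) t) _ _ _ ⟩
  (ballot (suc k) t + binomPred n t) + (ballot k (suc t) + binom n t)
    ≡⟨ cong₂ _+_ formula₁ (subst (λ m → ballot k (suc t) + binom m t ≡ binom m (suc t))
                                 (cong suc (sym (+-suc t k))) formula₂) ⟩
  binom n t + binom n (suc t) ∎
  where
  open ≡-Reasoning
  n = suc (t + suc k)

ballot-formula : ∀ k t → t ≤ suc k → BallotFormula k t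
ballot-formula k zero _ = trans (+-identityʳ _) (ballot-zeroʳ k)
ballot-formula k (suc t) (s≤s t≤k) with m≤n⇒m<n∨m≡n t≤k
ballot-formula k       (suc .k) _ | inj₂ refl = ballot-formula-diagonal k (ballot-formula k k (n≤1+n k))
ballot-formula (suc k) (suc t)  _ | inj₁ (s≤s t≤k) =
  ballot-formula-step k t t≤k (ballot-formula (suc k) t (m≤n⇒m≤1+n (m≤n⇒m≤1+n t≤k)))
                              (ballot-formula k (suc t) (s≤s t≤k))

-- With N = 2n + 1, absorption gives n C(N, n) = (n + 2) C(N, n − 1), whence
-- (n + 2) (C(N, n) − C(N, n − 1)) = 2 C(N, n) = C(N + 1, n + 1).
ballot-diagonal : ∀ n → ballot n n * (2 + n) ≡ binom (2 + (n + n)) (suc n)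
ballot-diagonal zero    = refl
ballot-diagonal (suc m) = +-cancelʳ-≡ (suc m * F) _ _ (begin
  D * (3 + m) + suc m * F            ≡⟨ cong (D * (3 + m) +_) absorbed ⟨
  D * (3 + m) + (3 + m) * G          ≡⟨ factor m D G ⟩
  (3 + m) * (D + G)                  ≡⟨ cong ((3 + m) *_) (ballot-formula n n (n≤1+n n)) ⟩
  (3 + m) * F                        ≡⟨ split m F ⟩
  F + F + suc m * F                  ≡⟨ cong (λ x → F + x + suc m * F) (binom-central n) ⟨
  binom (suc N) (suc n) + suc m * F  ∎)
  where
  open ≡-Reasoning
  n = suc m
  N = suc (n + n)
  D = ballot n n
  F = binom N n
  G = binom N m
  factor : ∀ m D G → D * (3 + m) + (3 + m) * G ≡ (3 + m) * (D + G)
  factor = solve-∀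
  split : ∀ m F → (3 + m) * F ≡ F + F + suc m * F
  split = solve-∀
  expand : ∀ m G → (3 + m) * G + m * G ≡ suc (suc m + suc m) * G
  expand = solve-∀
  absorbed : (3 + m) * G ≡ suc m * F
  absorbed = +-cancelʳ-≡ (m * G) _ _ (trans (expand m G) (sym (binom-absorb N m)))

-- The statement also holds for n = 0, where both sides are 1.
theorem10 : (n : ℕ) → 1 ≤ n → count n ≡ catalan (suc n)
theorem10 n _ = begin
  count n                         ≡⟨ count≡countFrom n ⟩
  countFrom n n                   ≡⟨ countFrom≡ballot n n ⟩
  ballot n n                      ≡⟨ m*n/n≡m (ballot n n) (2 + n) ⟨
  ballot n n * (2 + n) / (2 + n)  ≡⟨ cong (_/ (2 + n)) (trans (ballot-diagonal n) (sym numerator)) ⟩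
  catalan (suc n)                 ∎
  where
  open ≡-Reasoning
  double : ∀ n → 2 * suc n ≡ 2 + (n + n)
  double = solve-∀
  numerator : (2 * suc n) C suc n ≡ binom (2 + (n + n)) (suc n)
  numerator = trans (cong (_C suc n) (double n)) (C≡binom (2 + (n + n)) (suc n))
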